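{- Let $\mathcal{I}=((X,d),(\omega,m),(k_1,\dots,k_t),(r_1,\dots,r_t))$ be an instance of Robust $t$-NU$k$C. Run $\textsc{GreedyClustering}(X,X,r_t,3,\omega)$, obtaining centers $M$ and clusters $C(p)$, $p\in M$. Define $\lambda:X\to\mathbb{Z}_{\ge0}$ by $\lambda(p)=\omega(C(p))$ for $p\in M$ and $\lambda(p)=0$ for $p\in X\setminus M$, and let $\mathcal{I}'=((X,d),(\lambda,m),(k_1,\dots,k_t),(r'_1,\dots,r'_{t-1},0))$ where $r'_i=r_i+3r_t$ for $1\le i\le t-1$ (and $r'_t=0$). Then: (a) if $\mathcal{I}$ has a feasible solution, so does $\mathcal{I}'$; (b) given a solution $(\mathcal{B}'_i)_{i\in[t]}$ for $\mathcal{I}'$ that uses at most $k_i$ balls of radius $\alpha r'_i$ for every $i\in[t]$ (and covers $\lambda$-weight at least $m$), one can obtain a solution $(\mathcal{B}_i)_{i\in[t]}$ for $\mathcal{I}$ that uses at most $k_i$ balls of radius at most $\alpha r'_i+3r_t\le\alpha r_i+(3\alpha+3)r_t$ for $1\le i\le t$ (and covers $\omega$-weight at least $m$).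
   Context: $(X,d)$ is a finite metric space; $B(p,r)=\{q\in X:d(p,q)\le r\}$, balls centered at points of $X$; for $f$ on $X$ and $S\subseteq X$, $f(S)=\sum_{s\in S}f(s)$. An instance of Robust $t$-NU$k$C is $((X,d),(\omega,m),(k_1,\dots,k_t),(r_1,\dots,r_t))$ with $r_1\ge\dots\ge r_t\ge0$, non-negative integers $k_i$, weight $\omega:X\to\mathbb{Z}_{\ge0}$, integer $m$; a feasible solution is $(\mathcal{B}_1,\dots,\mathcal{B}_t)$ with $\mathcal{B}_i$ a set of at most $k_i$ balls of radius $r_i$ such that the covered points have total weight at least $m$. $\textsc{GreedyClustering}(Y,X,r,\gamma,\omega)$ (with $Y\subseteq X$, $r\ge0$, $\gamma\ge1$, $\omega:Y\to\mathbb{Z}_{\ge0}$): set $U\leftarrow Y$, $M\leftarrow\emptyset$; while $U\ne\emptyset$: choose $p\in X$ maximizing $\omega(U\cap B(p,r))$ among $q\in X$ with $U\cap B(q,r)\neq\emptyset$ (ties broken arbitrarily); set $C(p)=U\cap B(p,\gamma r)$, $wt(p)=\omega(C(p))$, $U\leftarrow U\setminus C(p)$, $M\leftarrow M\cup\{p\}$. It returns $M$, the clusters $C(p)$ and weights $wt(p)$; the clusters partition $Y$.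
   Formalization: The distances of d, the radii $r_i$ and the factor α take rational values rather than real ones. -}

module Defs where

open import Data.Bool using (Bool; true; false; if_then_else_)
open import Data.Nat as ℕ using (ℕ; suc)
open import Data.Integer as ℤ using (ℤ; +_)
open import Data.Rational as ℚ using (ℚ; 0ℚ; _≤_; _+_; _*_; _≤ᵇ_)
open import Data.Fin using (Fin; fromℕ)
open import Data.Fin.Subset using (Subset; _∩_; _─_; ⋃; ⊤; Nonempty; Empty)
open import Data.Vec as Vec using (Vec; tabulate; lookup)
open import Data.List as List using (List; []; _∷_; length; allFin)
open import Data.Product using (Σ; _×_; _,_)
open import Relation.Binary.PropositionalEquality using (_≡_)
open import Relation.Nullary using (yes; no)
open import Data.Fin using (_≟_)

record IsMetric (n : ℕ) (d : Fin n → Fin n → ℚ) : Set where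
  field
    nonneg   : ∀ p q → 0ℚ ≤ d p q
    self     : ∀ p → d p p ≡ 0ℚ
    separate : ∀ p q → d p q ≡ 0ℚ → p ≡ q
    symm     : ∀ p q → d p q ≡ d q p
    triangle : ∀ p q s → d p s ≤ d p q + d q s

wt : {n : ℕ} → (Fin n → ℕ) → Subset n → ℕ
wt {n} ω S = Vec.sum (tabulate (λ i → if lookup S i then ω i else 0))

ball : {n : ℕ} → (Fin n → Fin n → ℚ) → Fin n → ℚ → Subset n
ball d p r = tabulate (λ q → d p q ≤ᵇ r)

covered : {n t : ℕ} → (Fin n → Fin n → ℚ) → (Fin t → List (Fin n)) → (Fin t → ℚ) → Subset n
covered {n} {t} d B ρ =
  ⋃ (List.concat (List.map (λ i → List.map (λ c → ball d c (ρ i)) (B i)) (allFin t)))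

Feasible : {n t : ℕ} → (Fin n → Fin n → ℚ) → (Fin n → ℕ) → ℤ → (Fin t → ℕ) → (Fin t → ℚ) → Set
Feasible {n} {t} d ω m k ρ =
  Σ (Fin t → List (Fin n)) λ B →
    (∀ i → length (B i) ℕ.≤ k i) × (m ℤ.≤ + wt ω (covered d B ρ))

-- Runs of GreedyClustering(U, X, r, γ, ω), with arbitrary tie-breaking.
-- GreedyRun d ω r γ U L : the loop started with uncovered set U can
-- produce the list L of (center p, cluster C(p)) pairs, in order of choice.
data GreedyRun {n : ℕ} (d : Fin n → Fin n → ℚ) (ω : Fin n → ℕ) (r γ : ℚ)
     : Subset n → List (Fin n × Subset n) → Set where
  done : ∀ {U} → Empty U → GreedyRun d ω r γ U []
  step : ∀ {U L} (p : Fin n) →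
         Nonempty U →
         Nonempty (U ∩ ball d p r) →
         (∀ q → Nonempty (U ∩ ball d q r) →
                wt ω (U ∩ ball d q r) ℕ.≤ wt ω (U ∩ ball d p r)) →
         GreedyRun d ω r γ (U ─ ball d p (γ * r)) L →
         GreedyRun d ω r γ U ((p , U ∩ ball d p (γ * r)) ∷ L)

-- λ(p) = ω(C(p)) if p ∈ M, 0 otherwise (clusters with the same center are summed;
-- in a greedy run each center is chosen at most once).
clusterWeight : {n : ℕ} → (Fin n → ℕ) → List (Fin n × Subset n) → Fin n → ℕ
clusterWeight ω [] p = 0
clusterWeight ω ((c , C) ∷ L) p with c ≟ p
... | yes _ = wt ω C ℕ.+ clusterWeight ω L p
... | no  _ = clusterWeight ω L p

three : ℚ
three = ℚ.1ℚ + ℚ.1ℚ + ℚ.1ℚ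

reducedRadii : {t' : ℕ} → (Fin (suc t') → ℚ) → Fin (suc t') → ℚ
reducedRadii {t'} r i with i ≟ fromℕ t'
... | yes _ = 0ℚ
... | no  _ = r i + three * r (fromℕ t')

{-# OPTIONS --safe #-}
-- The clusters of a greedy run are pairwise disjoint and C(p) ⊆ B(p, 3 r_t), so λ(T) is at most
-- the ω-weight of the 3 r_t-neighbourhood of T; this is (b).
-- For (a), the balls of the classes i < t, enlarged by 3 r_t, contain every centre whose cluster
-- meets them. The k_t balls of radius r_t are traded, along the greedy run, for at most k_t balls
-- of radius 0. When the greedy picks a centre p that is not yet paid for while balls remain, p is
-- selected and balls are discarded: all remaining balls B(c, r_t) with d(p, c) ≤ 2 r_t, which lie
-- in B(p, 3 r_t), or, if there are none, a single ball B(c, r_t). In the latter case no point still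
-- to be paid for lies in B(p, r_t), and the greedy choice gives ω(U ∩ B(c, r_t)) ≤ ω(U ∩ B(p, r_t));
-- either way ω(C(p)) pays for everything lost.
module Submission where

open import Defs
open import Data.Nat using (ℕ; suc)
open import Data.Integer using (ℤ; +≤+)
open import Data.Rational using (ℚ; 0ℚ; _≤_; _+_; _*_; 1ℚ; nonNegative)
open import Data.Fin using (Fin; fromℕ; zero; suc) renaming (_≤_ to _≤ᶠ_)
open import Data.Fin.Subset using (Subset; ⊤; inside; outside; _∈_; _∉_; _⊆_; _∪_; _∩_; _─_; ⋃; Nonempty; Empty)
open import Data.List using (List; []; _∷_; length; filter; concat; map; allFin)
open import Data.Product using (_×_; ∃-syntax; _,_; proj₁; proj₂)

open import Data.Bool using (true; false; if_then_else_; _∨_)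
open import Data.Bool.Properties using (T-≡)
open import Data.Empty using (⊥-elim)
open import Data.Fin.Properties using (_≟_)
open import Data.Fin.Subset.Properties
  using (drop-∷-⊆; drop-∷-Empty; _∈?_; nonempty?; ∉⊥; ∈⊤; x∈p∪q⁺; x∈p∪q⁻; x∈p∩q⁺; x∈p∩q⁻; p∩q⊆p; p∩q⊆q;
         x∈p∧x∉q⇒x∈p─q; p─q⊆p)
import Data.Integer.Properties as ℤ
open import Data.List.Membership.Propositional using (lose; find) renaming (_∈_ to _∈ˡ_)
open import Data.List.Membership.Propositional.Properties using (∈-filter⁺; ∈-allFin)
open import Data.List.Properties using (filter-notAll)
open import Data.List.Relation.Unary.All as All using (All; _∷_)
open import Data.List.Relation.Unary.All.Properties using (¬Any⇒All¬)
open import Data.List.Relation.Unary.Any as Any using (Any; here; there; any?)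
open import Data.List.Relation.Unary.Any.Properties using (map⁺; map⁻; concat⁺; concat⁻)
open import Data.Nat as ℕ using (z≤n; s≤s)
import Data.Nat.Properties as ℕ
open import Algebra.Properties.CommutativeSemigroup ℕ.+-commutativeSemigroup using (interchange; x∙yz≈y∙xz)
import Data.Rational.Properties as ℚ
open import Data.Rational.Solver using (module +-*-Solver)
open import Data.Sum using (_⊎_; inj₁; inj₂; [_,_]′)
import Data.Sum as Sum
open import Data.Vec as Vec using ([]; _∷_)
open import Data.Vec.Functional using (updateAt)
open import Data.Vec.Functional.Properties using (updateAt-updates; updateAt-minimal)
open import Data.Vec.Properties using (lookup∘tabulate; lookup⇒[]=; []=⇒lookup)
open import Function using (_∘_; const)
open import Function.Bundles using (Equivalence)
open import Relation.Binary.PropositionalEquality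
open import Relation.Nullary using (does; yes; no; ¬_; ¬?)
open import Relation.Nullary.Decidable using (dec-true; dec-false)
open import Relation.Unary using (Decidable)

private
  variable
    n t : ℕ
    d : Fin n → Fin n → ℚ

-- Weights

wt-zero : (p : Subset n) → wt (λ _ → 0) p ≡ 0
wt-zero [] = refl
wt-zero (inside ∷ p) = wt-zero p
wt-zero (outside ∷ p) = wt-zero p

wt-Empty : (ω : Fin n → ℕ) {p : Subset n} → Empty p → wt ω p ≡ 0
wt-Empty ω {[]} _ = refl
wt-Empty ω {inside ∷ p} p-empty = ⊥-elim (p-empty (zero , Vec.here))
wt-Empty ω {outside ∷ p} p-empty = wt-Empty (ω ∘ suc) (drop-∷-Empty p-empty)

wt-≤-if-Nonempty : (ω : Fin n → ℕ) {p : Subset n} {k : ℕ} → (Nonempty p → wt ω p ℕ.≤ k) → wt ω p ℕ.≤ k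
wt-≤-if-Nonempty ω {p} bound with nonempty? p
... | yes p-nonempty = bound p-nonempty
... | no p-empty = ℕ.≤-trans (ℕ.≤-reflexive (wt-Empty ω p-empty)) z≤n

wt-mono : (ω : Fin n → ℕ) {p q : Subset n} → p ⊆ q → wt ω p ℕ.≤ wt ω q
wt-mono ω {[]} {[]} _ = z≤n
wt-mono ω {outside ∷ p} {s ∷ q} p⊆q = ℕ.≤-trans (wt-mono (ω ∘ suc) (drop-∷-⊆ p⊆q)) (ℕ.m≤n+m _ _)
wt-mono ω {inside ∷ p} {inside ∷ q} p⊆q = ℕ.+-monoʳ-≤ (ω zero) (wt-mono (ω ∘ suc) (drop-∷-⊆ p⊆q))
wt-mono ω {inside ∷ p} {outside ∷ q} p⊆q with () ← p⊆q Vec.here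

wt-∪ : (ω : Fin n → ℕ) (p q : Subset n) → wt ω (p ∪ q) ℕ.≤ wt ω p ℕ.+ wt ω q
wt-∪ ω [] [] = z≤n
wt-∪ ω (s ∷ p) (t ∷ q) = begin
  (if s ∨ t then ω zero else 0) ℕ.+ wt (ω ∘ suc) (p ∪ q)
    ≤⟨ ℕ.+-mono-≤ (if-∨ s) (wt-∪ (ω ∘ suc) p q) ⟩
  ((if s then ω zero else 0) ℕ.+ (if t then ω zero else 0)) ℕ.+ (wt (ω ∘ suc) p ℕ.+ wt (ω ∘ suc) q)
    ≡⟨ interchange (if s then ω zero else 0) (if t then ω zero else 0) _ _ ⟩
  ((if s then ω zero else 0) ℕ.+ wt (ω ∘ suc) p) ℕ.+ ((if t then ω zero else 0) ℕ.+ wt (ω ∘ suc) q) ∎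
  where
  open ℕ.≤-Reasoning
  if-∨ : ∀ s → (if s ∨ t then ω zero else 0) ℕ.≤ (if s then ω zero else 0) ℕ.+ (if t then ω zero else 0)
  if-∨ true = ℕ.m≤m+n _ _
  if-∨ false = ℕ.≤-refl

wt-⊆-∪ : (ω : Fin n → ℕ) {p : Subset n} (q s : Subset n) → p ⊆ q ∪ s → wt ω p ℕ.≤ wt ω q ℕ.+ wt ω s
wt-⊆-∪ ω q s p⊆q∪s = ℕ.≤-trans (wt-mono ω p⊆q∪s) (wt-∪ ω q s)

wt-∩+wt-─ : (ω : Fin n → ℕ) (p q : Subset n) → wt ω (p ∩ q) ℕ.+ wt ω (p ─ q) ≡ wt ω p
wt-∩+wt-─ ω [] [] = refl
wt-∩+wt-─ ω (inside ∷ p) (inside ∷ q) =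
  trans (ℕ.+-assoc (ω zero) _ _) (cong (ω zero ℕ.+_) (wt-∩+wt-─ (ω ∘ suc) p q))
wt-∩+wt-─ ω (inside ∷ p) (outside ∷ q) =
  trans (x∙yz≈y∙xz (wt (ω ∘ suc) (p ∩ q)) (ω zero) _) (cong (ω zero ℕ.+_) (wt-∩+wt-─ (ω ∘ suc) p q))
wt-∩+wt-─ ω (outside ∷ p) (inside ∷ q) = wt-∩+wt-─ (ω ∘ suc) p q
wt-∩+wt-─ ω (outside ∷ p) (outside ∷ q) = wt-∩+wt-─ (ω ∘ suc) p q

wt-cong : {f g : Fin n → ℕ} → (∀ x → f x ≡ g x) → (p : Subset n) → wt f p ≡ wt g p
wt-cong f≗g [] = refl
wt-cong f≗g (inside ∷ p) = cong₂ ℕ._+_ (f≗g zero) (wt-cong (f≗g ∘ suc) p)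
wt-cong f≗g (outside ∷ p) = wt-cong (f≗g ∘ suc) p

wt-+ : (f g : Fin n → ℕ) (p : Subset n) → wt (λ x → f x ℕ.+ g x) p ≡ wt f p ℕ.+ wt g p
wt-+ f g [] = refl
wt-+ f g (inside ∷ p) =
  trans (cong (f zero ℕ.+ g zero ℕ.+_) (wt-+ (f ∘ suc) (g ∘ suc) p))
        (interchange (f zero) (g zero) (wt (f ∘ suc) p) (wt (g ∘ suc) p))
wt-+ f g (outside ∷ p) = wt-+ (f ∘ suc) (g ∘ suc) p

wt-point : (c : Fin n) (w : ℕ) (p : Subset n) →
           wt (λ x → if does (c ≟ x) then w else 0) p ≡ (if does (c ∈? p) then w else 0)
wt-point zero w (inside ∷ p) = trans (cong (w ℕ.+_) (wt-zero p)) (ℕ.+-identityʳ w)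
wt-point zero w (outside ∷ p) = wt-zero p
wt-point (suc c) w (inside ∷ p) = wt-point c w p
wt-point (suc c) w (outside ∷ p) = wt-point c w p

clusterWeight-∷ : (ω : Fin n → ℕ) (c : Fin n) (C : Subset n) (L : List (Fin n × Subset n)) (x : Fin n) →
  clusterWeight ω ((c , C) ∷ L) x ≡ (if does (c ≟ x) then wt ω C else 0) ℕ.+ clusterWeight ω L x
clusterWeight-∷ ω c C L x with c ≟ x
... | yes _ = refl
... | no _ = refl

wt-clusterWeight-∷ : (ω : Fin n → ℕ) (c : Fin n) (C : Subset n) (L : List (Fin n × Subset n)) (T : Subset n) →
  wt (clusterWeight ω ((c , C) ∷ L)) T ≡ (if does (c ∈? T) then wt ω C else 0) ℕ.+ wt (clusterWeight ω L) T
wt-clusterWeight-∷ ω c C L T = begin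
  wt (clusterWeight ω ((c , C) ∷ L)) T
    ≡⟨ wt-cong (clusterWeight-∷ ω c C L) T ⟩
  wt (λ x → (if does (c ≟ x) then wt ω C else 0) ℕ.+ clusterWeight ω L x) T
    ≡⟨ wt-+ _ _ T ⟩
  wt (λ x → if does (c ≟ x) then wt ω C else 0) T ℕ.+ wt (clusterWeight ω L) T
    ≡⟨ cong (ℕ._+ _) (wt-point c (wt ω C) T) ⟩
  (if does (c ∈? T) then wt ω C else 0) ℕ.+ wt (clusterWeight ω L) T ∎
  where open ≡-Reasoning

wt-clusterWeight-∷-∈ : (ω : Fin n → ℕ) (c : Fin n) (C : Subset n) (L : List (Fin n × Subset n)) {T : Subset n} →
  c ∈ T → wt (clusterWeight ω ((c , C) ∷ L)) T ≡ wt ω C ℕ.+ wt (clusterWeight ω L) T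
wt-clusterWeight-∷-∈ ω c C L {T} c∈T =
  trans (wt-clusterWeight-∷ ω c C L T) (cong (λ b → (if b then wt ω C else 0) ℕ.+ _) (dec-true (c ∈? T) c∈T))

wt-clusterWeight-∷-∉ : (ω : Fin n → ℕ) (c : Fin n) (C : Subset n) (L : List (Fin n × Subset n)) {T : Subset n} →
  c ∉ T → wt (clusterWeight ω ((c , C) ∷ L)) T ≡ wt (clusterWeight ω L) T
wt-clusterWeight-∷-∉ ω c C L {T} c∉T =
  trans (wt-clusterWeight-∷ ω c C L T) (cong (λ b → (if b then wt ω C else 0) ℕ.+ _) (dec-false (c ∈? T) c∉T))

wt-clusterWeight-∷-≥ : (ω : Fin n → ℕ) (c : Fin n) (C : Subset n) (L : List (Fin n × Subset n)) (T : Subset n) →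
  wt (clusterWeight ω L) T ℕ.≤ wt (clusterWeight ω ((c , C) ∷ L)) T
wt-clusterWeight-∷-≥ ω c C L T = ℕ.≤-trans (ℕ.m≤n+m _ _) (ℕ.≤-reflexive (sym (wt-clusterWeight-∷ ω c C L T)))

≤-wt-clusterWeight-∷ : {ω : Fin n → ℕ} {c : Fin n} {C T : Subset n} {L : List (Fin n × Subset n)} {k k′ : ℕ} →
  c ∈ T → k ℕ.≤ wt ω C ℕ.+ k′ → k′ ℕ.≤ wt (clusterWeight ω L) T → k ℕ.≤ wt (clusterWeight ω ((c , C) ∷ L)) T
≤-wt-clusterWeight-∷ {ω = ω} {c} {C} {L = L} c∈T k≤ k′≤ =
  ℕ.≤-trans k≤ (ℕ.≤-trans (ℕ.+-monoʳ-≤ (wt ω C) k′≤)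
                          (ℕ.≤-reflexive (sym (wt-clusterWeight-∷-∈ ω c C L c∈T))))

-- Balls and coverings

x∈p─q⇒x∉q : {p q : Subset n} {x : Fin n} → x ∈ p ─ q → x ∉ q
x∈p─q⇒x∉q {p = _ ∷ _} {outside ∷ _} Vec.here ()
x∈p─q⇒x∉q {p = _ ∷ _} {_ ∷ _} (Vec.there x∈p─q) (Vec.there x∈q) = x∈p─q⇒x∉q x∈p─q x∈q

─∩⊆∩─ : (p q s : Subset n) → (p ─ s) ∩ q ⊆ (p ∩ q) ─ s
─∩⊆∩─ p q s x∈ with x∈p∩q⁻ (p ─ s) q x∈
... | x∈p─s , x∈q = x∈p∧x∉q⇒x∈p─q (x∈p∩q⁺ (p─q⊆p p s x∈p─s , x∈q)) (x∈p─q⇒x∉q x∈p─s)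

∈-ball⁺ : (d : Fin n → Fin n → ℚ) (p : Fin n) (s : ℚ) {x : Fin n} → d p x ≤ s → x ∈ ball d p s
∈-ball⁺ d p s {x} dpx≤s =
  lookup⇒[]= x (ball d p s) (trans (lookup∘tabulate _ x) (Equivalence.to T-≡ (ℚ.≤⇒≤ᵇ dpx≤s)))

∈-ball⁻ : (d : Fin n → Fin n → ℚ) (p : Fin n) (s : ℚ) {x : Fin n} → x ∈ ball d p s → d p x ≤ s
∈-ball⁻ d p s {x} x∈ball =
  ℚ.≤ᵇ⇒≤ (Equivalence.from T-≡ (trans (sym (lookup∘tabulate _ x)) ([]=⇒lookup x∈ball)))

∈-⋃⁺ : {Ss : List (Subset n)} {x : Fin n} → Any (x ∈_) Ss → x ∈ ⋃ Ss
∈-⋃⁺ (here x∈S) = x∈p∪q⁺ (inj₁ x∈S)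
∈-⋃⁺ (there x∈Ss) = x∈p∪q⁺ (inj₂ (∈-⋃⁺ x∈Ss))

∈-⋃⁻ : (Ss : List (Subset n)) {x : Fin n} → x ∈ ⋃ Ss → Any (x ∈_) Ss
∈-⋃⁻ [] x∈⊥ = ⊥-elim (∉⊥ x∈⊥)
∈-⋃⁻ (S ∷ Ss) x∈ = [ here , there ∘ ∈-⋃⁻ Ss ]′ (x∈p∪q⁻ S (⋃ Ss) x∈)

ballsAround : (Fin n → Fin n → ℚ) → List (Fin n) → ℚ → List (Subset n)
ballsAround d cs s = map (λ c → ball d c s) cs

balls : (Fin n → Fin n → ℚ) → List (Fin n) → ℚ → Subset n
balls d cs s = ⋃ (ballsAround d cs s)

ballsByClass : (Fin n → Fin n → ℚ) → (Fin t → List (Fin n)) → (Fin t → ℚ) → List (List (Subset n))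
ballsByClass {t = t} d B ρ = map (λ i → ballsAround d (B i) (ρ i)) (allFin t)

∈-balls⁺ : (d : Fin n → Fin n → ℚ) (cs : List (Fin n)) (s : ℚ) {x : Fin n} →
           Any (λ c → d c x ≤ s) cs → x ∈ balls d cs s
∈-balls⁺ d cs s = ∈-⋃⁺ ∘ map⁺ ∘ Any.map (∈-ball⁺ d _ s)

∈-balls⁻ : (d : Fin n → Fin n → ℚ) (cs : List (Fin n)) (s : ℚ) {x : Fin n} →
           x ∈ balls d cs s → Any (λ c → d c x ≤ s) cs
∈-balls⁻ d cs s = Any.map (∈-ball⁻ d _ s) ∘ map⁻ ∘ ∈-⋃⁻ (ballsAround d cs s)

∈-covered⁺ : (d : Fin n → Fin n → ℚ) (B : Fin t → List (Fin n)) (ρ : Fin t → ℚ) {i : Fin t} {b x : Fin n} →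
             b ∈ˡ B i → d b x ≤ ρ i → x ∈ covered d B ρ
∈-covered⁺ d B ρ {i} b∈Bi dbx≤ρi =
  ∈-⋃⁺ (concat⁺ (map⁺ (lose (∈-allFin i) (map⁺ (lose b∈Bi (∈-ball⁺ d _ (ρ i) dbx≤ρi))))))

∈-covered⁻ : (d : Fin n → Fin n → ℚ) (B : Fin t → List (Fin n)) (ρ : Fin t → ℚ) {x : Fin n} →
             x ∈ covered d B ρ → ∃[ i ] ∃[ b ] b ∈ˡ B i × d b x ≤ ρ i
∈-covered⁻ d B ρ x∈
  with find (map⁻ (concat⁻ (ballsByClass d B ρ) (∈-⋃⁻ (concat (ballsByClass d B ρ)) x∈)))
... | i , _ , x∈Bi with find (map⁻ x∈Bi)
...   | b , b∈Bi , x∈ball = i , b , b∈Bi , ∈-ball⁻ d b (ρ i) x∈ball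

covered-mono : (d : Fin n → Fin n → ℚ) (B B′ : Fin t → List (Fin n)) (ρ : Fin t → ℚ) →
               (∀ {i b} → b ∈ˡ B i → b ∈ˡ B′ i) → covered d B ρ ⊆ covered d B′ ρ
covered-mono d B B′ ρ B⊆B′ x∈ with ∈-covered⁻ d B ρ x∈
... | _ , _ , b∈Bi , dbx≤ρi = ∈-covered⁺ d B′ ρ (B⊆B′ b∈Bi) dbx≤ρi

module _ {A : Set} (B : Fin t → List A) (j : Fin t) where

  ∈-updateAt-≢ : {f : List A → List A} {i : Fin t} {b : A} → i ≢ j → b ∈ˡ B i → b ∈ˡ updateAt B j f i
  ∈-updateAt-≢ {i = i} i≢j = subst (_ ∈ˡ_) (sym (updateAt-minimal i j B i≢j))

  ∈-updateAt-const : {xs : List A} {b : A} → b ∈ˡ xs → b ∈ˡ updateAt B j (const xs) j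
  ∈-updateAt-const = subst (_ ∈ˡ_) (sym (updateAt-updates j B))

  ∈-updateAt-[]⁻ : {i : Fin t} {b : A} → b ∈ˡ updateAt B j (const []) i → i ≢ j × b ∈ˡ B i
  ∈-updateAt-[]⁻ {i} b∈ with i ≟ j
  ... | yes refl with () ← subst (_ ∈ˡ_) (updateAt-updates j B) b∈
  ... | no i≢j = i≢j , subst (_ ∈ˡ_) (updateAt-minimal i j B i≢j) b∈

  length-updateAt-≤ : {xs : List A} {k : Fin t → ℕ} → length xs ℕ.≤ k j → (∀ i → length (B i) ℕ.≤ k i) →
                      ∀ i → length (updateAt B j (const xs) i) ℕ.≤ k i
  length-updateAt-≤ {xs} {k} |xs|≤ |B|≤k i with i ≟ j
  ... | yes refl = subst (λ ys → length ys ℕ.≤ k j) (sym (updateAt-updates j B)) |xs|≤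
  ... | no i≢j = subst (λ ys → length ys ℕ.≤ k i) (sym (updateAt-minimal i j B i≢j)) (|B|≤k i)

covered-⊆-others∪balls : (d : Fin n → Fin n → ℚ) (B : Fin t → List (Fin n)) (ρ : Fin t → ℚ) (j : Fin t) →
  covered d B ρ ⊆ covered d (updateAt B j (const [])) ρ ∪ balls d (B j) (ρ j)
covered-⊆-others∪balls d B ρ j x∈ with ∈-covered⁻ d B ρ x∈
... | i , b , b∈Bi , dbx≤ρi with i ≟ j
...   | yes refl = x∈p∪q⁺ (inj₂ (∈-balls⁺ d (B i) (ρ i) (lose b∈Bi dbx≤ρi)))
...   | no i≢j = x∈p∪q⁺ (inj₁ (∈-covered⁺ d _ ρ (∈-updateAt-≢ B j i≢j b∈Bi) dbx≤ρi))

module Metric {d : Fin n → Fin n → ℚ} (metric : IsMetric n d) where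
  open IsMetric metric

  dist-≤-+ : ∀ {a b c s s′} → d a b ≤ s → d b c ≤ s′ → d a c ≤ s + s′
  dist-≤-+ dab≤s dbc≤s′ = ℚ.≤-trans (triangle _ _ _) (ℚ.+-mono-≤ dab≤s dbc≤s′)

  dist-sym-≤ : ∀ {a b s} → d a b ≤ s → d b a ≤ s
  dist-sym-≤ {a} {b} = subst (_≤ _) (symm a b)

  covered-expand : {B : Fin t → List (Fin n)} {ρ : Fin t → ℚ} {δ : ℚ} {x y : Fin n} →
    x ∈ covered d B ρ → d x y ≤ δ → y ∈ covered d B (λ i → ρ i + δ)
  covered-expand {B = B} {ρ} {δ} x∈ dxy≤δ with ∈-covered⁻ d B ρ x∈
  ... | _ , _ , b∈Bi , dbx≤ρi = ∈-covered⁺ d B (λ i → ρ i + δ) b∈Bi (dist-≤-+ dbx≤ρi dxy≤δ)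

-- Greedy runs

wt-clusterWeight-≤ : {ω : Fin n → ℕ} {r γ : ℚ} {U T S : Subset n} {L : List (Fin n × Subset n)} →
  GreedyRun d ω r γ U L → (∀ {p x} → p ∈ T → d p x ≤ γ * r → x ∈ S) →
  wt (clusterWeight ω L) T ℕ.≤ wt ω (U ∩ S)
wt-clusterWeight-≤ {T = T} (done _) _ = ℕ.≤-trans (ℕ.≤-reflexive (wt-zero T)) z≤n
wt-clusterWeight-≤ {n = n} {d = d} {ω} {r} {γ} {U} {T} {S} (step {L = L} p _ _ _ run) T-near⇒S with p ∈? T
... | no p∉T = begin
  wt (clusterWeight ω ((p , C) ∷ L)) T      ≡⟨ wt-clusterWeight-∷-∉ ω p C L p∉T ⟩
  wt (clusterWeight ω L) T                  ≤⟨ wt-clusterWeight-≤ run T-near⇒S ⟩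
  wt ω ((U ─ B) ∩ S)                        ≤⟨ wt-mono ω (p─q⊆p (U ∩ S) B ∘ ─∩⊆∩─ U S B) ⟩
  wt ω (U ∩ S)                              ∎
  where
  open ℕ.≤-Reasoning
  B C : Subset n
  B = ball d p (γ * r)
  C = U ∩ B
... | yes p∈T = begin
  wt (clusterWeight ω ((p , C) ∷ L)) T       ≡⟨ wt-clusterWeight-∷-∈ ω p C L p∈T ⟩
  wt ω C ℕ.+ wt (clusterWeight ω L) T        ≤⟨ ℕ.+-mono-≤ (wt-mono ω C⊆U∩S∩B) (wt-clusterWeight-≤ run T-near⇒S) ⟩
  wt ω ((U ∩ S) ∩ B) ℕ.+ wt ω ((U ─ B) ∩ S)  ≤⟨ ℕ.+-monoʳ-≤ _ (wt-mono ω (─∩⊆∩─ U S B)) ⟩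
  wt ω ((U ∩ S) ∩ B) ℕ.+ wt ω ((U ∩ S) ─ B)  ≡⟨ wt-∩+wt-─ ω (U ∩ S) B ⟩
  wt ω (U ∩ S)                               ∎
  where
  open ℕ.≤-Reasoning
  B C : Subset n
  B = ball d p (γ * r)
  C = U ∩ B
  C⊆U∩S∩B : C ⊆ (U ∩ S) ∩ B
  C⊆U∩S∩B x∈C with x∈p∩q⁻ U B x∈C
  ... | x∈U , x∈B = x∈p∩q⁺ (x∈p∩q⁺ (x∈U , T-near⇒S p∈T (∈-ball⁻ d p (γ * r) x∈B)) , x∈B)

-- O is the part covered by the classes i < t, and G contains every centre within γ r of O, so the
-- clusters centred in G are paid for by those classes.
module Charging {d : Fin n → Fin n → ℚ} (metric : IsMetric n d) (ω : Fin n → ℕ) {r γ : ℚ}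
       (0≤r : 0ℚ ≤ r) (3r≤γr : r + r + r ≤ γ * r)
       (O G : Subset n) (O-near⇒G : ∀ {p x} → x ∈ O → d p x ≤ γ * r → p ∈ G) where

  open Metric metric

  r≤γr : r ≤ γ * r
  r≤γr = ℚ.≤-trans (subst (_≤ r + r + r) (ℚ.+-identityˡ r) (ℚ.+-monoˡ-≤ r (ℚ.+-mono-≤ 0≤r 0≤r))) 3r≤γr

  cluster remaining : Subset n → Fin n → Subset n
  cluster U p = U ∩ ball d p (γ * r)
  remaining U p = U ─ ball d p (γ * r)

  GreedyChoice : Subset n → Fin n → Set
  GreedyChoice U p = ∀ q → Nonempty (U ∩ ball d q r) → wt ω (U ∩ ball d q r) ℕ.≤ wt ω (U ∩ ball d p r)

  -- The points of U still to be paid for, cs being the centres of the radius-r balls not yet discarded.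
  reached : Subset n → List (Fin n) → Subset n
  reached U cs = U ∩ (O ∪ balls d cs r)

  Near : Fin n → Fin n → Set
  Near p c = d p c ≤ r + r

  near? : (p : Fin n) → Decidable (Near p)
  near? p c = d p c ℚ.≤? r + r

  far? : (p : Fin n) → Decidable (¬_ ∘ Near p)
  far? p = ¬? ∘ near? p

  ∈-reached-remaining : ∀ {U p} cs {x} → x ∈ U → x ∉ ball d p (γ * r) → x ∈ O ∪ balls d cs r →
                        x ∈ reached (remaining U p) cs
  ∈-reached-remaining _ x∈U x∉B x∈O∪ = x∈p∩q⁺ (x∈p∧x∉q⇒x∈p─q x∈U x∉B , x∈O∪)

  reached-⊆-cluster∪ : ∀ {U p cs cs′} → (∀ {c} → c ∈ˡ cs → c ∈ˡ cs′ ⊎ Near p c) →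
                       reached U cs ⊆ cluster U p ∪ reached (remaining U p) cs′
  reached-⊆-cluster∪ {U} {p} {cs} {cs′} kept {x} x∈ with x∈p∩q⁻ U _ x∈
  ... | x∈U , x∈O∪ with x ∈? ball d p (γ * r)
  ...   | yes x∈B = x∈p∪q⁺ (inj₁ (x∈p∩q⁺ (x∈U , x∈B)))
  ...   | no x∉B =
    x∈p∪q⁺ (inj₂ (∈-reached-remaining cs′ x∈U x∉B (x∈p∪q⁺ (Sum.map₂ still-reached (x∈p∪q⁻ O _ x∈O∪)))))
    where
    still-reached : x ∈ balls d cs r → x ∈ balls d cs′ r
    still-reached x∈balls with find (∈-balls⁻ d cs r x∈balls)
    ... | c , c∈cs , dcx≤r with kept c∈cs
    ...   | inj₁ c∈cs′ = ∈-balls⁺ d cs′ r (lose c∈cs′ dcx≤r)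
    ...   | inj₂ dpc≤2r = ⊥-elim (x∉B (∈-ball⁺ d p (γ * r) (ℚ.≤-trans (dist-≤-+ dpc≤2r dcx≤r) 3r≤γr)))

  reached-[]-⊆ : ∀ {U p} → p ∉ G → reached U [] ⊆ reached (remaining U p) []
  reached-[]-⊆ {U} {p} p∉G {x} x∈ with x∈p∩q⁻ U _ x∈
  ... | x∈U , x∈O∪⊥ = ∈-reached-remaining [] x∈U x∉B x∈O∪⊥
    where
    x∉B : x ∉ ball d p (γ * r)
    x∉B x∈B with x∈p∪q⁻ O _ x∈O∪⊥
    ... | inj₁ x∈O = p∉G (O-near⇒G x∈O (∈-ball⁻ d p (γ * r) x∈B))
    ... | inj₂ x∈⊥ = ∉⊥ x∈⊥

  reached-⊆-far : ∀ {U p c cs} → p ∉ G → All (¬_ ∘ Near p) (c ∷ cs) →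
    reached U (c ∷ cs) ⊆ U ∩ ball d c r ∪ (cluster U p ─ ball d p r) ∪ reached (remaining U p) cs
  reached-⊆-far {U} {p} {c} {cs} p∉G far {x} x∈ with x∈p∩q⁻ U _ x∈
  ... | x∈U , x∈O∪ with x ∈? ball d p (γ * r)
  ...   | yes x∈B = x∈p∪q⁺ (inj₂ (x∈p∪q⁺ (inj₁ (x∈p∧x∉q⇒x∈p─q (x∈p∩q⁺ (x∈U , x∈B)) x∉Bʳ))))
    where
    x∉Bʳ : x ∉ ball d p r
    x∉Bʳ x∈Bʳ with x∈p∪q⁻ O _ x∈O∪
    ... | inj₁ x∈O = p∉G (O-near⇒G x∈O (ℚ.≤-trans (∈-ball⁻ d p r x∈Bʳ) r≤γr))
    ... | inj₂ x∈balls with find (∈-balls⁻ d (c ∷ cs) r x∈balls)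
    ...   | c′ , c′∈ , dc′x≤r = All.lookup far c′∈ (dist-≤-+ (∈-ball⁻ d p r x∈Bʳ) (dist-sym-≤ dc′x≤r))
  ...   | no x∉B with x∈p∪q⁻ O _ x∈O∪
  ...     | inj₁ x∈O = x∈p∪q⁺ (inj₂ (x∈p∪q⁺ (inj₂ (∈-reached-remaining cs x∈U x∉B (x∈p∪q⁺ (inj₁ x∈O))))))
  ...     | inj₂ x∈balls with ∈-balls⁻ d (c ∷ cs) r x∈balls
  ...       | here dcx≤r = x∈p∪q⁺ (inj₁ (x∈p∩q⁺ (x∈U , ∈-ball⁺ d c r dcx≤r)))
  ...       | there x∈balls′ =
    x∈p∪q⁺ (inj₂ (x∈p∪q⁺ (inj₂
      (∈-reached-remaining cs x∈U x∉B (x∈p∪q⁺ (inj₂ (∈-balls⁺ d cs r x∈balls′)))))))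

  wt-reached-far : ∀ {U p c cs} → p ∉ G → GreedyChoice U p → All (¬_ ∘ Near p) (c ∷ cs) →
    wt ω (reached U (c ∷ cs)) ℕ.≤ wt ω (cluster U p) ℕ.+ wt ω (reached (remaining U p) cs)
  wt-reached-far {U} {p} {c} {cs} p∉G greedy far = begin
    wt ω (reached U (c ∷ cs))
      ≤⟨ wt-⊆-∪ ω (U ∩ ball d c r) ((C ─ Bʳ) ∪ R) (reached-⊆-far p∉G far) ⟩
    wt ω (U ∩ ball d c r) ℕ.+ wt ω ((C ─ Bʳ) ∪ R)
      ≤⟨ ℕ.+-mono-≤ (wt-≤-if-Nonempty ω (greedy c)) (wt-∪ ω (C ─ Bʳ) R) ⟩
    wt ω (U ∩ Bʳ) ℕ.+ (wt ω (C ─ Bʳ) ℕ.+ wt ω R)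
      ≡⟨ ℕ.+-assoc (wt ω (U ∩ Bʳ)) _ _ ⟨
    wt ω (U ∩ Bʳ) ℕ.+ wt ω (C ─ Bʳ) ℕ.+ wt ω R
      ≤⟨ ℕ.+-monoˡ-≤ (wt ω R) (ℕ.+-monoˡ-≤ (wt ω (C ─ Bʳ)) (wt-mono ω U∩Bʳ⊆C∩Bʳ)) ⟩
    wt ω (C ∩ Bʳ) ℕ.+ wt ω (C ─ Bʳ) ℕ.+ wt ω R
      ≡⟨ cong (ℕ._+ wt ω R) (wt-∩+wt-─ ω C Bʳ) ⟩
    wt ω C ℕ.+ wt ω R ∎
    where
    open ℕ.≤-Reasoning
    C Bʳ R : Subset n
    C = cluster U p
    Bʳ = ball d p r
    R = reached (remaining U p) cs
    U∩Bʳ⊆C∩Bʳ : U ∩ Bʳ ⊆ C ∩ Bʳ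
    U∩Bʳ⊆C∩Bʳ x∈ with x∈p∩q⁻ U Bʳ x∈
    ... | x∈U , x∈Bʳ =
      x∈p∩q⁺ (x∈p∩q⁺ (x∈U , ∈-ball⁺ d p (γ * r) (ℚ.≤-trans (∈-ball⁻ d p r x∈Bʳ) r≤γr)) , x∈Bʳ)

  kept-or-near : ∀ p {c cs} → c ∈ˡ cs → c ∈ˡ filter (far? p) cs ⊎ Near p c
  kept-or-near p {c} c∈cs with near? p c
  ... | yes near = inj₂ near
  ... | no ¬near = inj₁ (∈-filter⁺ (far? p) c∈cs ¬near)

  charge-step : ∀ {U p} c cs → p ∉ G → GreedyChoice U p →
    ∃[ cs′ ] length cs′ ℕ.< length (c ∷ cs)
           × wt ω (reached U (c ∷ cs)) ℕ.≤ wt ω (cluster U p) ℕ.+ wt ω (reached (remaining U p) cs′)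
  charge-step {U} {p} c cs p∉G greedy with any? (near? p) (c ∷ cs)
  ... | yes some-near =
    filter (far? p) (c ∷ cs) ,
    filter-notAll (far? p) (c ∷ cs) (Any.map (λ near far → far near) some-near) ,
    wt-⊆-∪ ω (cluster U p) (reached (remaining U p) (filter (far? p) (c ∷ cs)))
             (reached-⊆-cluster∪ {U} {p} {c ∷ cs} (kept-or-near p))
  ... | no none-near = cs , ℕ.≤-refl , wt-reached-far p∉G greedy (¬Any⇒All¬ (c ∷ cs) none-near)

  charge : ∀ {U L} → GreedyRun d ω r γ U L → ∀ cs →
    ∃[ S ] length S ℕ.≤ length cs
         × (∀ {T} → G ⊆ T → All (_∈ T) S → wt ω (reached U cs) ℕ.≤ wt (clusterWeight ω L) T)
  charge {U} (done U-empty) cs = [] , z≤n , λ _ _ → ℕ.≤-trans reached-empty z≤n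
    where
    reached-empty : wt ω (reached U cs) ℕ.≤ 0
    reached-empty = ℕ.≤-trans (wt-mono ω (p∩q⊆p U _)) (ℕ.≤-reflexive (wt-Empty ω U-empty))
  charge {U} (step p _ _ greedy run) cs with p ∈? G | cs
  ... | yes p∈G | cs with charge run cs
  ...   | S , |S|≤ , bound = S , |S|≤ , λ G⊆T S⊆T →
    ≤-wt-clusterWeight-∷ (G⊆T p∈G)
      (wt-⊆-∪ ω (cluster U p) (reached (remaining U p) cs) (reached-⊆-cluster∪ {U} {p} {cs} inj₁))
      (bound G⊆T S⊆T)
  charge {U} (step p _ _ greedy run) cs | no p∉G | [] with charge run []
  ...   | S , |S|≤ , bound = S , |S|≤ , λ {T} G⊆T S⊆T →
    ℕ.≤-trans (wt-mono ω (reached-[]-⊆ {U} p∉G))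
              (ℕ.≤-trans (bound G⊆T S⊆T) (wt-clusterWeight-∷-≥ ω p _ _ T))
  charge {U} (step p _ _ greedy run) cs | no p∉G | c ∷ cs₀ with charge-step c cs₀ p∉G greedy
  ...   | cs′ , shorter , step-bound with charge run cs′
  ...     | S , |S|≤ , bound = p ∷ S , ℕ.≤-trans (s≤s |S|≤) shorter , λ where
    G⊆T (p∈T ∷ S⊆T) → ≤-wt-clusterWeight-∷ p∈T step-bound (bound G⊆T S⊆T)

-- Radii

three-* : ∀ x → three * x ≡ x + x + x
three-* x = solve 1 (λ x → (con 1ℚ :+ con 1ℚ :+ con 1ℚ) :* x := x :+ x :+ x) refl x
  where open +-*-Solver

module _ {t′ : ℕ} (r : Fin (suc t′) → ℚ) where

  reducedRadii-last : reducedRadii r (fromℕ t′) ≡ 0ℚ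
  reducedRadii-last with fromℕ t′ ≟ fromℕ t′
  ... | yes _ = refl
  ... | no last≢last = ⊥-elim (last≢last refl)

  reducedRadii-≢ : ∀ {i} → i ≢ fromℕ t′ → reducedRadii r i ≡ r i + three * r (fromℕ t′)
  reducedRadii-≢ {i} i≢last with i ≟ fromℕ t′
  ... | yes i≡last = ⊥-elim (i≢last i≡last)
  ... | no _ = refl

  reducedRadii-≤ : 0ℚ ≤ r (fromℕ t′) → ∀ i → reducedRadii r i ≤ r i + three * r (fromℕ t′)
  reducedRadii-≤ 0≤rₜ i with i ≟ fromℕ t′
  ... | yes refl = ℚ.+-mono-≤ 0≤rₜ (ℚ.*-monoˡ-≤-nonNeg three 0≤rₜ)
  ... | no _ = ℚ.≤-refl

  scaled-reducedRadii-≤ : 0ℚ ≤ r (fromℕ t′) → {α : ℚ} → 0ℚ ≤ α → ∀ i →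
    α * reducedRadii r i + three * r (fromℕ t′) ≤ α * r i + (three * α + 1ℚ + 1ℚ + 1ℚ) * r (fromℕ t′)
  scaled-reducedRadii-≤ 0≤rₜ {α} 0≤α i = begin
    α * reducedRadii r i + three * rₜ
      ≤⟨ ℚ.+-monoˡ-≤ (three * rₜ) (ℚ.*-monoˡ-≤-nonNeg α ⦃ nonNegative 0≤α ⦄ (reducedRadii-≤ 0≤rₜ i)) ⟩
    α * (r i + three * rₜ) + three * rₜ
      ≡⟨ solve 3 (λ α a b → α :* (a :+ three′ :* b) :+ three′ :* b
                          := α :* a :+ (three′ :* α :+ one :+ one :+ one) :* b) refl α (r i) rₜ ⟩
    α * r i + (three * α + 1ℚ + 1ℚ + 1ℚ) * rₜ ∎
    where
    open ℚ.≤-Reasoning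
    open +-*-Solver
    rₜ : ℚ
    rₜ = r (fromℕ t′)
    one three′ : ∀ {m} → Polynomial m
    one = con 1ℚ
    three′ = one :+ one :+ one

lifted-feasible : {d : Fin n → Fin n → ℚ} {ω : Fin n → ℕ} {m : ℤ} {k : Fin t → ℕ} {ρ : Fin t → ℚ} {s γ : ℚ}
  {L : List (Fin n × Subset n)} → IsMetric n d → GreedyRun d ω s γ ⊤ L →
  Feasible d (clusterWeight ω L) m k ρ → Feasible d ω m k (λ i → ρ i + γ * s)
lifted-feasible {d = d} {ω} {ρ = ρ} {s} {γ} {L} metric run (B , |B|≤k , m≤λ) =
  B , |B|≤k , ℤ.≤-trans m≤λ (+≤+ clusters≤ω)
  where
  open Metric metric
  clusters≤ω : wt (clusterWeight ω L) (covered d B ρ) ℕ.≤ wt ω (covered d B (λ i → ρ i + γ * s))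
  clusters≤ω = ℕ.≤-trans (wt-clusterWeight-≤ {T = covered d B ρ} run (covered-expand {B = B} {ρ}))
                         (wt-mono ω (p∩q⊆q ⊤ _))

reduced-feasible : ∀ {t′} {d : Fin n → Fin n → ℚ} {ω : Fin n → ℕ} {m : ℤ} {k : Fin (suc t′) → ℕ}
  {r : Fin (suc t′) → ℚ} {L : List (Fin n × Subset n)} → IsMetric n d → 0ℚ ≤ r (fromℕ t′) →
  GreedyRun d ω (r (fromℕ t′)) three ⊤ L →
  Feasible d ω m k r → Feasible d (clusterWeight ω L) m k (reducedRadii r)
reduced-feasible {n} {t′} {d} {ω} {k = k} {r} {L} metric 0≤rₜ run (B , |B|≤k , m≤ω) =
  B′ , |B′|≤k , ℤ.≤-trans m≤ω (+≤+ (ℕ.≤-trans (wt-mono ω covered⊆reached) (bound G⊆T S⊆T)))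
  where
  open IsMetric metric
  open Metric metric
  last : Fin (suc t′)
  last = fromℕ t′

  others : Fin (suc t′) → List (Fin n)
  others = updateAt B last (const [])

  O G : Subset n
  O = covered d others r
  G = covered d others (reducedRadii r)

  O-near⇒G : ∀ {p x} → x ∈ O → d p x ≤ three * r last → p ∈ G
  O-near⇒G {p} x∈O dpx≤ with ∈-covered⁻ d others r x∈O
  ... | i , b , b∈ , dbx≤ri = ∈-covered⁺ d others (reducedRadii r) b∈
    (subst (d b p ≤_) (sym (reducedRadii-≢ r (proj₁ (∈-updateAt-[]⁻ B last b∈))))
           (dist-≤-+ dbx≤ri (dist-sym-≤ dpx≤)))

  open Charging metric ω {γ = three} 0≤rₜ (ℚ.≤-reflexive (sym (three-* (r last)))) O G O-near⇒G

  S : List (Fin n)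
  S = proj₁ (charge run (B last))

  |S|≤ : length S ℕ.≤ length (B last)
  |S|≤ = proj₁ (proj₂ (charge run (B last)))

  bound : ∀ {T} → G ⊆ T → All (_∈ T) S → wt ω (reached ⊤ (B last)) ℕ.≤ wt (clusterWeight ω L) T
  bound = proj₂ (proj₂ (charge run (B last)))

  B′ : Fin (suc t′) → List (Fin n)
  B′ = updateAt B last (const S)

  |B′|≤k : ∀ i → length (B′ i) ℕ.≤ k i
  |B′|≤k = length-updateAt-≤ B last (ℕ.≤-trans |S|≤ (|B|≤k last)) |B|≤k

  covered⊆reached : covered d B r ⊆ reached ⊤ (B last)
  covered⊆reached x∈ = x∈p∩q⁺ (∈⊤ , covered-⊆-others∪balls d B r last x∈)

  G⊆T : G ⊆ covered d B′ (reducedRadii r)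
  G⊆T = covered-mono d others B′ (reducedRadii r) λ b∈ →
    let i≢last , b∈Bi = ∈-updateAt-[]⁻ B last b∈ in ∈-updateAt-≢ B last i≢last b∈Bi

  S⊆T : All (_∈ covered d B′ (reducedRadii r)) S
  S⊆T = All.tabulate λ {p} p∈S → ∈-covered⁺ d B′ (reducedRadii r) (∈-updateAt-const B last p∈S)
                                     (ℚ.≤-reflexive (trans (self p) (sym (reducedRadii-last r))))

lemma2 : ∀ {n t' : ℕ} (d : Fin n → Fin n → ℚ) → IsMetric n d →
  (ω : Fin n → ℕ) (m : ℤ) (k : Fin (suc t') → ℕ) (r : Fin (suc t') → ℚ) →
  (∀ i j → i ≤ᶠ j → r j ≤ r i) → 0ℚ ≤ r (fromℕ t') →
  (L : List (Fin n × Subset n)) → GreedyRun d ω (r (fromℕ t')) three ⊤ L →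
  (Feasible d ω m k r → Feasible d (clusterWeight ω L) m k (reducedRadii r))
  × ((α : ℚ) → 0ℚ ≤ α →
      Feasible d (clusterWeight ω L) m k (λ i → α * reducedRadii r i) →
      Feasible d ω m k (λ i → α * reducedRadii r i + three * r (fromℕ t')))
  × ((α : ℚ) → 0ℚ ≤ α → ∀ i →
      α * reducedRadii r i + three * r (fromℕ t')
        ≤ α * r i + (three * α + 1ℚ + 1ℚ + 1ℚ) * r (fromℕ t'))
lemma2 d metric ω m k r _ 0≤rₜ L run =
  reduced-feasible metric 0≤rₜ run ,
  (λ α _ → lifted-feasible {ρ = λ i → α * reducedRadii r i} metric run) ,
  (λ α 0≤α → scaled-reducedRadii-≤ r 0≤rₜ 0≤α)
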